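{- Let $U$ be a nonempty set, $\mathcal{D}$ a family of partitions of $U$ closed under joins, and $\mathcal{S}$ a family of subsets of $U$ such that each member of $\mathcal{S}$ is a union of blocks of some partition in $\mathcal{D}$, $\mathcal{S}$ is closed under intersection and contains $U$ and $\emptyset$ (so that $(\mathcal{S};\{\sigma_P:P\in\mathcal{D}\},\cap,U,\emptyset)$ is a set algebra). Let $P_1,P_2,P\in\mathcal{D}$ with $P_1\perp P_2\mid P$. (1) If $X,Y\in\mathcal{S}$ with $\sigma_{P_1}(X)=X$ and $\sigma_{P_2}(Y)=Y$, then $\sigma_P(X\cap Y)=\sigma_P(X)\cap\sigma_P(Y)$. (2) If $X\in\mathcal{S}$ with $\sigma_{P_1}(X)=X$, then $\sigma_{P_2}(X)=\sigma_{P_2}(\sigma_P(X))$.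
   Context: Partitions of $U$ are ordered by $P\le Q$ iff every block of $Q$ lies in a block of $P$; the join $P\vee Q$ has as blocks the nonempty intersections of a block of $P$ with a block of $Q$. $u\equiv_P u'$ means $u,u'$ lie in the same block of $P$. The saturation operator of $P$ is $\sigma_P(S)=\{u\in U:\exists u'\in S,\ u\equiv_P u'\}$ for $S\subseteq U$. For partitions $P_1,P_2,P$, $P_1\perp P_2\mid P$ means: for every block $B$ of $P$, block $B_1$ of $P_1$, block $B_2$ of $P_2$ with $B_1\cap B\ne\emptyset\ne B_2\cap B$, we have $B_1\cap B_2\cap B\ne\emptyset$. -}

module Defs where

open import Level using (Level; _⊔_) renaming (suc to lsuc; zero to lzero)
open import Data.Product using (Σ; ∃; _×_; _,_)
open import Data.Unit using (⊤)
open import Data.Empty using (⊥)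
open import Relation.Binary.Structures using (IsEquivalence)

Subset : Set → Set₁
Subset U = U → Set

_⊆_ : {U : Set} → Subset U → Subset U → Set
X ⊆ Y = ∀ u → X u → Y u

_≐_ : {U : Set} → Subset U → Subset U → Set
X ≐ Y = (X ⊆ Y) × (Y ⊆ X)

_∩_ : {U : Set} → Subset U → Subset U → Subset U
(X ∩ Y) u = X u × Y u

Full : {U : Set} → Subset U
Full _ = ⊤

Empty : {U : Set} → Subset U
Empty _ = ⊥

-- A partition of U, given by its "same block" relation u ≡_P u'
-- (an equivalence relation; blocks are its equivalence classes).
record Partition (U : Set) : Set₁ where
  field
    _∼_   : U → U → Set
    isEq  : IsEquivalence _∼_

open Partition public

IsBlock : {U : Set} → Partition U → Subset U → Set
IsBlock P B = Σ _ λ u → ∀ v → (B v → _∼_ P u v) × (_∼_ P u v → B v)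

-- join P ∨ Q: blocks are the nonempty intersections of blocks,
-- i.e. u, u' are in the same block iff same block in P and in Q.
_∨_ : {U : Set} → Partition U → Partition U → Partition U
_∼_ (P ∨ Q) u v = _∼_ P u v × _∼_ Q u v
isEq (P ∨ Q) = record
  { refl  = IsEquivalence.refl (isEq P) , IsEquivalence.refl (isEq Q)
  ; sym   = λ { (a , b) → IsEquivalence.sym (isEq P) a , IsEquivalence.sym (isEq Q) b }
  ; trans = λ { (a , b) (c , d) → IsEquivalence.trans (isEq P) a c , IsEquivalence.trans (isEq Q) b d }
  }

σ : {U : Set} → Partition U → Subset U → Subset U
σ P S u = Σ _ λ u' → S u' × _∼_ P u u'

Indep : {U : Set} → Partition U → Partition U → Partition U → Set₁
Indep {U} P₁ P₂ P =
  (B B₁ B₂ : Subset U) → IsBlock P B → IsBlock P₁ B₁ → IsBlock P₂ B₂ →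
  (Σ U λ u → B₁ u × B u) → (Σ U λ u → B₂ u × B u) →
  Σ U λ u → B₁ u × B₂ u × B u

module Submission where

-- Both parts rest on the pointwise reading of P₁ ⊥ P₂ ∣ P: if the P₁-class
-- of x and the P₂-class of y both meet the P-block of u, then some z in
-- that block is P₁-equivalent to x and P₂-equivalent to y. A P₁-saturated
-- set containing x then contains z, which gives the missing inclusions
-- σ_P X ∩ σ_P Y ⊆ σ_P (X ∩ Y) and σ_P₂ (σ_P X) ⊆ σ_P₂ X; the other two
-- inclusions hold for any partition since σ_P is monotone and extensive.

open import Defs
open import Data.Product using (Σ; _×_; _,_)
open import Relation.Binary.Structures using (IsEquivalence)

module _ {U : Set} where

  ∼-refl : (P : Partition U) {u : U} → _∼_ P u u
  ∼-refl P = IsEquivalence.refl (isEq P)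

  ∼-sym : (P : Partition U) {u v : U} → _∼_ P u v → _∼_ P v u
  ∼-sym P = IsEquivalence.sym (isEq P)

  class : Partition U → U → Subset U
  class P u = _∼_ P u

  class-isBlock : (P : Partition U) (u : U) → IsBlock P (class P u)
  class-isBlock P u = u , λ _ → (λ u∼v → u∼v) , (λ u∼v → u∼v)

  ⊆-σ : (P : Partition U) (X : Subset U) → X ⊆ σ P X
  ⊆-σ P X u u∈X = u , u∈X , ∼-refl P

  σ-mono : (P : Partition U) {X Y : Subset U} → X ⊆ Y → σ P X ⊆ σ P Y
  σ-mono P X⊆Y u (w , w∈X , u∼w) = w , X⊆Y w w∈X , u∼w

  σ-∩-⊆ : (P : Partition U) (X Y : Subset U) → σ P (X ∩ Y) ⊆ (σ P X ∩ σ P Y)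
  σ-∩-⊆ P X Y u (w , (w∈X , w∈Y) , u∼w) = (w , w∈X , u∼w) , (w , w∈Y , u∼w)

  saturated-∼-closed : (P : Partition U) {X : Subset U} → σ P X ⊆ X →
                       ∀ {x z} → X x → _∼_ P x z → X z
  saturated-∼-closed P σX⊆X x∈X x∼z = σX⊆X _ (_ , x∈X , ∼-sym P x∼z)

module Independence {U : Set} (P₁ P₂ P : Partition U) (indep : Indep P₁ P₂ P) where

  meet : ∀ {u x y} → σ P (class P₁ x) u → σ P (class P₂ y) u →
         Σ U λ z → _∼_ P₁ x z × _∼_ P₂ y z × _∼_ P u z
  meet {u} {x} {y} (a , x∼a , u∼a) (b , y∼b , u∼b) =
    indep (class P u) (class P₁ x) (class P₂ y)
          (class-isBlock P u) (class-isBlock P₁ x) (class-isBlock P₂ y)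
          (a , x∼a , u∼a) (b , y∼b , u∼b)

  σ-∩-⊇ : {X Y : Subset U} → σ P₁ X ⊆ X → σ P₂ Y ⊆ Y →
          (σ P X ∩ σ P Y) ⊆ σ P (X ∩ Y)
  σ-∩-⊇ σ₁X⊆X σ₂Y⊆Y u ((x , x∈X , u∼x) , (y , y∈Y , u∼y))
    with meet (x , ∼-refl P₁ , u∼x) (y , ∼-refl P₂ , u∼y)
  ... | z , x∼z , y∼z , u∼z =
    z , (saturated-∼-closed P₁ σ₁X⊆X x∈X x∼z , saturated-∼-closed P₂ σ₂Y⊆Y y∈Y y∼z) , u∼z

  σ-σ-⊆ : {X : Subset U} → σ P₁ X ⊆ X → σ P₂ (σ P X) ⊆ σ P₂ X
  σ-σ-⊆ σ₁X⊆X u (w , (x , x∈X , w∼x) , u∼w)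
    with meet (x , ∼-refl P₁ , w∼x) (w , u∼w , ∼-refl P)
  ... | z , x∼z , u∼z , _ = z , saturated-∼-closed P₁ σ₁X⊆X x∈X x∼z , u∼z

mainTheorem6 : (U : Set) → U →
    (D : Partition U → Set) →
    (∀ P Q → D P → D Q → D (P ∨ Q)) →
    (S : Subset U → Set) →
    (∀ X → S X → Σ (Partition U) λ P → D P × (σ P X ≐ X)) →
    (∀ X Y → S X → S Y → S (X ∩ Y)) →
    S Full → S Empty →
    (P₁ P₂ P : Partition U) → D P₁ → D P₂ → D P →
    Indep P₁ P₂ P →
    ((X Y : Subset U) → S X → S Y → σ P₁ X ≐ X → σ P₂ Y ≐ Y →
      σ P (X ∩ Y) ≐ (σ P X ∩ σ P Y))
    ×
    ((X : Subset U) → S X → σ P₁ X ≐ X → σ P₂ X ≐ σ P₂ (σ P X))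
mainTheorem6 U _ D _ S _ _ _ _ P₁ P₂ P _ _ _ indep = σ-∩ , σ₂-σ
  where
  open Independence P₁ P₂ P indep

  σ-∩ : (X Y : Subset U) → S X → S Y → σ P₁ X ≐ X → σ P₂ Y ≐ Y →
        σ P (X ∩ Y) ≐ (σ P X ∩ σ P Y)
  σ-∩ X Y _ _ (σ₁X⊆X , _) (σ₂Y⊆Y , _) =
    σ-∩-⊆ P X Y , σ-∩-⊇ σ₁X⊆X σ₂Y⊆Y

  σ₂-σ : (X : Subset U) → S X → σ P₁ X ≐ X → σ P₂ X ≐ σ P₂ (σ P X)
  σ₂-σ X _ (σ₁X⊆X , _) =
    σ-mono P₂ (⊆-σ P X) , σ-σ-⊆ σ₁X⊆X
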